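{- Let $S$ be a set and consider the poset of basic topologies on $S$. The maps $T\mapsto T^R$ and $T\mapsto T^S$ are monotone and idempotent, and satisfy $T^R\leq T\leq T^S$ for every basic topology $T$ on $S$; i.e. $(\ )^R$ is a reduction (comonad) and $(\ )^S$ is a saturation (monad) on this poset.
   Context: All reasoning is intuitionistic (no law of excluded middle); impredicative constructions allowed. An operator on $S$ is a map $\mathrm{Pow}(S)\to\mathrm{Pow}(S)$, ordered pointwise by inclusion. For $U,V\subseteq S$, $U\between V$ means there exists $a\in U\cap V$. $\mathcal{O}\triangleleft\mathcal{O}'$ means: for all $U,V\subseteq S$, $\mathcal{O}(U)\between\mathcal{O}'(V)$ implies $U\between\mathcal{O}'(V)$. A saturation is a monotone idempotent operator $\mathcal{A}$ with $U\subseteq\mathcal{A}(U)$ for all $U$; a reduction is a monotone idempotent operator $\mathcal{J}$ with $\mathcal{J}(U)\subseteq U$ for all $U$. For a reduction $\mathcal{J}$, $\mathbb{A}(\mathcal{J})$ is the greatest saturation $\mathcal{A}$ with $\mathcal{A}\triangleleft\mathcal{J}$; for a saturation $\mathcal{A}$, $\mathbb{J}(\mathcal{A})$ is the greatest reduction $\mathcal{J}$ with $\mathcal{A}\triangleleft\mathcal{J}$ (both exist). A basic topology on $S$ is a pair $[\mathcal{A},\mathcal{J}]$ with $\mathcal{A}$ a saturation, $\mathcal{J}$ a reduction and $\mathcal{A}\triangleleft\mathcal{J}$, ordered by $[\mathcal{A}_1,\mathcal{J}_1]\leq[\mathcal{A}_2,\mathcal{J}_2]$ iff $\mathcal{A}_2\subseteq\mathcal{A}_1$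 and $\mathcal{J}_1\subseteq\mathcal{J}_2$. For $T=[\mathcal{A},\mathcal{J}]$, $T^R=[\mathbb{A}(\mathcal{J}),\mathcal{J}]$ and $T^S=[\mathcal{A},\mathbb{J}(\mathcal{A})]$. -}

module Defs where

open import Level using (Level; suc; _⊔_)
open import Data.Product using (Σ; ∃; _×_; _,_)

Pow : ∀ {ℓ} → Set ℓ → Set (suc ℓ)
Pow {ℓ} S = S → Set ℓ

_⊆_ : ∀ {ℓ} {S : Set ℓ} → Pow S → Pow S → Set ℓ
U ⊆ V = ∀ {a} → U a → V a

_≬_ : ∀ {ℓ} {S : Set ℓ} → Pow S → Pow S → Set ℓ
_≬_ {S = S} U V = Σ S λ a → U a × V a

Op : ∀ {ℓ} → Set ℓ → Set (suc ℓ)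
Op S = Pow S → Pow S

_≤op_ : ∀ {ℓ} {S : Set ℓ} → Op S → Op S → Set (suc ℓ)
O ≤op O' = ∀ U → O U ⊆ O' U

_◁_ : ∀ {ℓ} {S : Set ℓ} → Op S → Op S → Set (suc ℓ)
O ◁ O' = ∀ U V → O U ≬ O' V → U ≬ O' V

Monotone : ∀ {ℓ} {S : Set ℓ} → Op S → Set (suc ℓ)
Monotone O = ∀ U V → U ⊆ V → O U ⊆ O V

Idempotent : ∀ {ℓ} {S : Set ℓ} → Op S → Set (suc ℓ)
Idempotent O = ∀ U → (O (O U) ⊆ O U) × (O U ⊆ O (O U))

record IsSaturation {ℓ} {S : Set ℓ} (A : Op S) : Set (suc ℓ) where
  field
    mono    : Monotone A
    idem    : Idempotent A
    reflexive : ∀ U → U ⊆ A U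

record IsReduction {ℓ} {S : Set ℓ} (J : Op S) : Set (suc ℓ) where
  field
    mono    : Monotone J
    idem    : Idempotent J
    coreflexive : ∀ U → J U ⊆ U

IsGreatestSatFor : ∀ {ℓ} {S : Set ℓ} → Op S → Op S → Set (suc ℓ)
IsGreatestSatFor J A =
  IsSaturation A × (A ◁ J) × (∀ A' → IsSaturation A' → A' ◁ J → A' ≤op A)

IsGreatestRedFor : ∀ {ℓ} {S : Set ℓ} → Op S → Op S → Set (suc ℓ)
IsGreatestRedFor A J =
  IsReduction J × (A ◁ J) × (∀ J' → IsReduction J' → A ◁ J' → J' ≤op J)

-- Specification of the maps 𝔸 and 𝕁 (the paper asserts they exist)
𝔸-Spec : ∀ {ℓ} {S : Set ℓ} → (Op S → Op S) → Set (suc ℓ)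
𝔸-Spec 𝔸 = ∀ J → IsReduction J → IsGreatestSatFor J (𝔸 J)

𝕁-Spec : ∀ {ℓ} {S : Set ℓ} → (Op S → Op S) → Set (suc ℓ)
𝕁-Spec 𝕁 = ∀ A → IsSaturation A → IsGreatestRedFor A (𝕁 A)

record BasicTopology {ℓ} (S : Set ℓ) : Set (suc ℓ) where
  field
    𝒜 : Op S
    𝒥 : Op S
    sat : IsSaturation 𝒜
    red : IsReduction 𝒥
    compat : 𝒜 ◁ 𝒥

open BasicTopology public

_≤T_ : ∀ {ℓ} {S : Set ℓ} → BasicTopology S → BasicTopology S → Set (suc ℓ)
T₁ ≤T T₂ = (𝒜 T₂ ≤op 𝒜 T₁) × (𝒥 T₁ ≤op 𝒥 T₂)

_≈T_ : ∀ {ℓ} {S : Set ℓ} → BasicTopology S → BasicTopology S → Set (suc ℓ)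
T₁ ≈T T₂ = (T₁ ≤T T₂) × (T₂ ≤T T₁)

_^R : ∀ {ℓ} {S : Set ℓ} {𝔸 : Op S → Op S} → {𝔸-Spec 𝔸} → BasicTopology S → BasicTopology S
_^R {𝔸 = 𝔸} {spec} T with spec (𝒥 T) (red T)
... | s , c , _ = record { 𝒜 = 𝔸 (𝒥 T) ; 𝒥 = 𝒥 T ; sat = s ; red = red T ; compat = c }

_^S : ∀ {ℓ} {S : Set ℓ} {𝕁 : Op S → Op S} → {𝕁-Spec 𝕁} → BasicTopology S → BasicTopology S
_^S {𝕁 = 𝕁} {spec} T with spec (𝒜 T) (sat T)
... | r , c , _ = record { 𝒜 = 𝒜 T ; 𝒥 = 𝕁 (𝒜 T) ; sat = sat T ; red = r ; compat = c }

-- Compatibility A ◁ J is antitone in A, and antitone in J among reductions; with the maximality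
-- of 𝔸 J and 𝕁 A this gives monotonicity, while R T ≤T T and T ≤T Sa T are maximality itself.
module Submission where

open import Defs
open import Data.Product using (_×_; _,_; proj₁; proj₂)

module _ {ℓ} {S : Set ℓ} where

  ≤op-refl : {O : Op S} → O ≤op O
  ≤op-refl U x = x

  ≤T-refl : {T : BasicTopology S} → T ≤T T
  ≤T-refl {T} = ≤op-refl {O = 𝒜 T} , ≤op-refl {O = 𝒥 T}

  ≈T-refl : {T : BasicTopology S} → T ≈T T
  ≈T-refl {T} = ≤T-refl {T = T} , ≤T-refl {T = T}

  ◁-antitoneˡ : {A A' J : Op S} → A' ≤op A → A ◁ J → A' ◁ J
  ◁-antitoneˡ A'≤A A◁J U V (a , a∈A'U , a∈JV) = A◁J U V (a , A'≤A U a∈A'U , a∈JV)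

  -- Each J₁ V is a fixed point of J₂, so compatibility with J₂ at J₁ V is compatibility with J₁ at V.
  ◁-antitoneʳ : {A J₁ J₂ : Op S} → IsReduction J₁ → IsReduction J₂ →
                J₁ ≤op J₂ → A ◁ J₂ → A ◁ J₁
  ◁-antitoneʳ {J₁ = J₁} {J₂} red₁ red₂ J₁≤J₂ A◁J₂ U V (a , a∈AU , a∈J₁V)
    with A◁J₂ U (J₁ V) (a , a∈AU , J₁V⊆J₂J₁V a∈J₁V)
    where
    J₁V⊆J₂J₁V : J₁ V ⊆ J₂ (J₁ V)
    J₁V⊆J₂J₁V b∈J₁V = J₁≤J₂ (J₁ V) (proj₂ (IsReduction.idem red₁ V) b∈J₁V)
  ... | b , b∈U , b∈J₂J₁V = b , b∈U , IsReduction.coreflexive red₂ (J₁ V) b∈J₂J₁V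

module Reduction {ℓ} {S : Set ℓ} (𝔸 : Op S → Op S) (spec : 𝔸-Spec 𝔸) where

  R : BasicTopology S → BasicTopology S
  R T = _^R {𝔸 = 𝔸} {spec} T

  𝔸-greatest : ∀ J → IsReduction J → ∀ A → IsSaturation A → A ◁ J → A ≤op 𝔸 J
  𝔸-greatest J red-J = proj₂ (proj₂ (spec J red-J))

  R-monotone : ∀ T₁ T₂ → T₁ ≤T T₂ → R T₁ ≤T R T₂
  R-monotone T₁ T₂ (_ , 𝒥₁≤𝒥₂) =
    𝔸-greatest (𝒥 T₁) (red T₁) (𝔸 (𝒥 T₂)) (sat (R T₂))
      (◁-antitoneʳ (red T₁) (red T₂) 𝒥₁≤𝒥₂ (compat (R T₂)))
    , 𝒥₁≤𝒥₂

  -- R (R T) and R T are definitionally equal: R keeps 𝒥, and 𝔸 is applied to 𝒥 only.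
  R-idempotent : ∀ T → R (R T) ≈T R T
  R-idempotent T = ≈T-refl {T = R T}

  R-deflationary : ∀ T → R T ≤T T
  R-deflationary T = 𝔸-greatest (𝒥 T) (red T) (𝒜 T) (sat T) (compat T) , ≤op-refl {O = 𝒥 T}

module Saturation {ℓ} {S : Set ℓ} (𝕁 : Op S → Op S) (spec : 𝕁-Spec 𝕁) where

  Sa : BasicTopology S → BasicTopology S
  Sa T = _^S {𝕁 = 𝕁} {spec} T

  𝕁-greatest : ∀ A → IsSaturation A → ∀ J → IsReduction J → A ◁ J → J ≤op 𝕁 A
  𝕁-greatest A sat-A = proj₂ (proj₂ (spec A sat-A))

  Sa-monotone : ∀ T₁ T₂ → T₁ ≤T T₂ → Sa T₁ ≤T Sa T₂
  Sa-monotone T₁ T₂ (𝒜₂≤𝒜₁ , _) =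
    𝒜₂≤𝒜₁
    , 𝕁-greatest (𝒜 T₂) (sat T₂) (𝕁 (𝒜 T₁)) (red (Sa T₁))
        (◁-antitoneˡ 𝒜₂≤𝒜₁ (compat (Sa T₁)))

  Sa-idempotent : ∀ T → Sa (Sa T) ≈T Sa T
  Sa-idempotent T = ≈T-refl {T = Sa T}

  Sa-inflationary : ∀ T → T ≤T Sa T
  Sa-inflationary T = ≤op-refl {O = 𝒜 T} , 𝕁-greatest (𝒜 T) (sat T) (𝒥 T) (red T) (compat T)

corollary3p5 : ∀ {ℓ} (S : Set ℓ)
    (𝔸 : Op S → Op S) (𝔸-spec : 𝔸-Spec 𝔸)
    (𝕁 : Op S → Op S) (𝕁-spec : 𝕁-Spec 𝕁) →
    let R : BasicTopology S → BasicTopology S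
        R T = _^R {𝔸 = 𝔸} {𝔸-spec} T
        Sa : BasicTopology S → BasicTopology S
        Sa T = _^S {𝕁 = 𝕁} {𝕁-spec} T
    in ((∀ T₁ T₂ → T₁ ≤T T₂ → R T₁ ≤T R T₂)
        × (∀ T → R (R T) ≈T R T)
        × (∀ T → R T ≤T T))
       × ((∀ T₁ T₂ → T₁ ≤T T₂ → Sa T₁ ≤T Sa T₂)
        × (∀ T → Sa (Sa T) ≈T Sa T)
        × (∀ T → T ≤T Sa T))
corollary3p5 S 𝔸 𝔸-spec 𝕁 𝕁-spec =
  (R-monotone , R-idempotent , R-deflationary) , (Sa-monotone , Sa-idempotent , Sa-inflationary)
  where
  open Reduction 𝔸 𝔸-spec
  open Saturation 𝕁 𝕁-spec
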